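{- Let $(N_1,C_1)$ and $(N_2,C_2)$ be coherent nets and $E$ a Presburger formula with free variables in $P_1\cup P_2$, and suppose $(N_1,C_1)\approxeq_E(N_2,C_2)$. Let $a,b\in\Sigma$. Writing $T^-_i(a)$ and $T^+_i(a,b)$ for the operations $T^-(a)$ and $T^+(a,b)$ applied to $N_i$, we have: (1) for $i=1,2$, $(T^-_i(a),C_i)$ and $(T^+_i(a,b),C_i)$ are coherent nets; (2) $(T^-_1(a),C_1)\approxeq_E(T^-_2(a),C_2)$; (3) $(T^+_1(a,b),C_1)\approxeq_E(T^+_2(a,b),C_2)$.
   Context: A labeled Petri net $N=(P,T,\mathrm{Pre},\mathrm{Post})$ has finite place set $P$, finite transition set $T$, $\mathrm{Pre},\mathrm{Post}:T\to(P\to\mathbb N)$ and labeling $l:T\to\Sigma\cup\{\tau\}$ with $\tau\notin\Sigma$ silent. A marking is $m:P\to\mathbb N$. $t$ is enabled at $m$ if $m(p)\ge\mathrm{Pre}(t,p)$ for all $p$, and then $m\xrightarrow{t}m'$ with $m'=m-\mathrm{Pre}(t)+\mathrm{Post}(t)$; $m\xRightarrow{\varrho}m'$ is firing along $\varrho\in T^*$. Extend $l$ to $T^*$ by erasing $\tau$. For $\sigma\in\Sigma^*$, $m\xRightarrow{\sigma}m'$ means some $\varrho$ with $l(\varrho)=\sigma$ has $m\xRightarrow{\varrho}m'$ ($m\xRightarrow{\epsilon}m'$: reachability using only silent transitions). $m\overset{\epsilon}{\twoheadrightarrow}m'$ iff $m=m'$; for $\sigma\in\Sigma^*,c\in\Sigma$,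 $m\overset{\sigma c}{\twoheadrightarrow}m'$ iff there exist $m''$, $t$ with $l(t)=c$ and $m\xRightarrow{\sigma}m''\xrightarrow{t}m'$. For a Presburger formula $C$ over the places of $N$, $(N,C)$ is a coherent net if for every $m\models C$, $\sigma\in\Sigma^*$, $m\xRightarrow{\sigma}m'$ there is $m''\models C$ with $m\overset{\sigma}{\twoheadrightarrow}m''$ and $m''\xRightarrow{\epsilon}m'$. For markings $m_1\in\mathbb N^{P_1}$, $m_2\in\mathbb N^{P_2}$ (place sets may share places): $m_1\equiv_E m_2$ means they agree on $P_1\cap P_2$ and $m_1\cup m_2$ satisfies $E$ over $\mathbb N$; $m_1\langle C_1EC_2\rangle m_2$ means $m_1\models C_1$, $m_1\equiv_E m_2$, $m_2\models C_2$. $(N_1,C_1)\preceq_E(N_2,C_2)$ means: (S1) for every $m_1\models C_1$ there is $m_2$ with $m_1\langle C_1EC_2\rangle m_2$; (S2) for all $m_1\xRightarrow{\epsilon}m_1'$ in $N_1$ and all $m_2$, $m_1\equiv_E m_2$ implies $m_1'\equiv_E m_2$; (S3) for all $\sigma\in\Sigma^*$, $m_1\xRightarrow{\sigma}m_1'$ in $N_1$ and $m_2,m_2'$ with $m_1\langle C_1EC_2\rangle m_2$ and $m_1'\equiv_E m_2'$, we have $m_2\xRightarrow{\sigma}m_2'$ in $N_2$. $(N_1,C_1)\approxeq_E(N_2,C_2)$ means $(N_1,C_1)\preceq_E(N_2,C_2)$ and $(N_2,C_2)\preceq_E(N_1,C_1)$. Transition operations on a net $N=(P,T,\mathrm{Pre},\mathrm{Post})$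 with labeling $l$, for $a,b\in\Sigma$: $T^-(a)$ is the net $(P,T',\mathrm{Pre}',\mathrm{Post}')$ with $T'=T\setminus l^{ -1}(a)$ and $\mathrm{Pre}',\mathrm{Post}',l$ restricted to $T'$ (it removes all transitions labeled $a$). $T^+(a,b)$ is the net $(P,T',\mathrm{Pre}',\mathrm{Post}')$ with $T'=(T\times\{0\})\cup(l^{ -1}(a)\times\{1\})$, $\mathrm{Pre}'(t,i)=\mathrm{Pre}(t)$, $\mathrm{Post}'(t,i)=\mathrm{Post}(t)$, and labeling $l'(t,0)=l(t)$, $l'(t,1)=b$ (it duplicates every transition labeled $a$, labeling the copy $b$). -}

module Defs where

open import Data.Nat using (ℕ; suc; _+_; _*_; _∸_; _≤_)
import Data.Nat as Nat
open import Data.Fin using (Fin; zero; suc)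
open import Data.Bool using (if_then_else_)
open import Data.List using (List; []; _∷_; _++_; map; mapMaybe; _∷ʳ_)
open import Data.List.Membership.Propositional using (_∈_)
open import Data.List.Membership.DecPropositional Nat._≟_ using (_∈?_)
open import Data.List.Membership.Propositional.Properties using (∈-++⁺ˡ; ∈-++⁺ʳ; ∈-map⁺)
open import Data.List.Relation.Unary.Any using (here; there)
open import Data.List.Relation.Unary.All using (All)
open import Data.Maybe using (Maybe; just; nothing)
open import Data.Maybe.Properties using (≡-dec)
open import Data.Product using (Σ; ∃; _×_; _,_)
open import Data.Sum using (_⊎_; inj₁; inj₂)
open import Data.Empty using (⊥)
import Data.Empty.Irrelevant as Irr
open import Relation.Nullary using (¬_; Dec; yes; no; does)
open import Relation.Binary.Definitions using (DecidableEquality)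
open import Relation.Binary.PropositionalEquality using (_≡_; _≢_; refl)

-- Presburger arithmetic (over ℕ).
-- Free variables are place names (ℕ); bound variables are de Bruijn
-- indices Fin k (zero = innermost binder).

data Term (k : ℕ) : Set where
  const : ℕ → Term k
  pvar  : ℕ → Term k
  bvar  : Fin k → Term k
  _⊕_   : Term k → Term k → Term k
  _⊛_   : ℕ → Term k → Term k

data Form (k : ℕ) : Set where
  _≐_ _≼_         : Term k → Term k → Form k
  ⊤' ⊥'           : Form k
  ¬'_             : Form k → Form k
  _∧'_ _∨'_ _⇒'_  : Form k → Form k → Form k
  ∃' ∀'           : Form (suc k) → Form k

extend : {k : ℕ} → ℕ → (Fin k → ℕ) → Fin (suc k) → ℕ
extend n β zero    = n
extend n β (suc i) = β i

⟦_⟧t : {k : ℕ} → Term k → (ℕ → ℕ) → (Fin k → ℕ) → ℕ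
⟦ const n ⟧t ρ β = n
⟦ pvar p  ⟧t ρ β = ρ p
⟦ bvar i  ⟧t ρ β = β i
⟦ s ⊕ t   ⟧t ρ β = ⟦ s ⟧t ρ β + ⟦ t ⟧t ρ β
⟦ n ⊛ t   ⟧t ρ β = n * ⟦ t ⟧t ρ β

data ⊤ₛ : Set where
  tt : ⊤ₛ

⟦_⟧ : {k : ℕ} → Form k → (ℕ → ℕ) → (Fin k → ℕ) → Set
⟦ s ≐ t  ⟧ ρ β = ⟦ s ⟧t ρ β ≡ ⟦ t ⟧t ρ β
⟦ s ≼ t  ⟧ ρ β = ⟦ s ⟧t ρ β ≤ ⟦ t ⟧t ρ β
⟦ ⊤'     ⟧ ρ β = ⊤ₛ
⟦ ⊥'     ⟧ ρ β = ⊥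
⟦ ¬' φ   ⟧ ρ β = ¬ ⟦ φ ⟧ ρ β
⟦ φ ∧' ψ ⟧ ρ β = ⟦ φ ⟧ ρ β × ⟦ ψ ⟧ ρ β
⟦ φ ∨' ψ ⟧ ρ β = ⟦ φ ⟧ ρ β ⊎ ⟦ ψ ⟧ ρ β
⟦ φ ⇒' ψ ⟧ ρ β = ⟦ φ ⟧ ρ β → ⟦ ψ ⟧ ρ β
⟦ ∃' φ   ⟧ ρ β = Σ ℕ λ n → ⟦ φ ⟧ ρ (extend n β)
⟦ ∀' φ   ⟧ ρ β = (n : ℕ) → ⟦ φ ⟧ ρ (extend n β)

Presburger : Set
Presburger = Form 0

noBound : Fin 0 → ℕ
noBound ()

_⊨_ : (ℕ → ℕ) → Presburger → Set
ρ ⊨ φ = ⟦ φ ⟧ ρ noBound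

fvt : {k : ℕ} → Term k → List ℕ
fvt (const n) = []
fvt (pvar p)  = p ∷ []
fvt (bvar i)  = []
fvt (s ⊕ t)   = fvt s ++ fvt t
fvt (n ⊛ t)   = fvt t

fv : {k : ℕ} → Form k → List ℕ
fv (s ≐ t)  = fvt s ++ fvt t
fv (s ≼ t)  = fvt s ++ fvt t
fv ⊤'       = []
fv ⊥'       = []
fv (¬' φ)   = fv φ
fv (φ ∧' ψ) = fv φ ++ fv ψ
fv (φ ∨' ψ) = fv φ ++ fv ψ
fv (φ ⇒' ψ) = fv φ ++ fv ψ
fv (∃' φ)   = fv φ
fv (∀' φ)   = fv φ

-- Places are names in ℕ (so different nets can
-- share places); the finite place set is a list.  Labels:
-- nothing = τ (silent), just c = visible label c ∈ A (= Σ).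

record Net (A : Set) : Set₁ where
  field
    places     : List ℕ
    Tr         : Set
    trList     : List Tr
    trComplete : (t : Tr) → t ∈ trList
    Pre Post   : Tr → ℕ → ℕ
    lab        : Tr → Maybe A
open Net public

-- Markings are functions ℕ → ℕ; only their values on the places of
-- the net under consideration matter (markings are identified up to
-- agreement on the places).
Marking : Set
Marking = ℕ → ℕ

module _ {A : Set} (N : Net A) where

  _≈ₘ_ : Marking → Marking → Set
  m ≈ₘ m' = (p : ℕ) → p ∈ places N → m p ≡ m' p

  Fire : Marking → Tr N → Marking → Set
  Fire m t m' = (p : ℕ) → p ∈ places N →
                (Pre N t p ≤ m p) × (m' p ≡ (m p ∸ Pre N t p) + Post N t p)

  data Run : Marking → List (Tr N) → Marking → Set where
    done : {m m' : Marking} → m ≈ₘ m' → Run m [] m'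
    step : {m m'' m' : Marking} {t : Tr N} {ϱ : List (Tr N)} →
           Fire m t m'' → Run m'' ϱ m' → Run m (t ∷ ϱ) m'

  labels : List (Tr N) → List A
  labels = mapMaybe (lab N)

  WRun : Marking → List A → Marking → Set
  WRun m σ m' = Σ (List (Tr N)) λ ϱ → labels ϱ ≡ σ × Run m ϱ m'

  data SRun : Marking → List A → Marking → Set where
    snil  : {m m' : Marking} → m ≈ₘ m' → SRun m [] m'
    ssnoc : {m m'' m' : Marking} {σ : List A} {c : A} {t : Tr N} →
            WRun m σ m'' → lab N t ≡ just c → Fire m'' t m' →
            SRun m (σ ∷ʳ c) m'

Coherent : {A : Set} → Net A → Presburger → Set
Coherent N C = (m m' : Marking) (σ : List _) → m ⊨ C → WRun N m σ m' →
  Σ Marking λ m'' → (m'' ⊨ C) × SRun N m σ m'' × WRun N m'' [] m'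

_∪[_]_ : Marking → List ℕ → Marking → Marking
(m₁ ∪[ P₁ ] m₂) p = if does (p ∈? P₁) then m₁ p else m₂ p

EqE : {A : Set} → Net A → Net A → Presburger → Marking → Marking → Set
EqE N₁ N₂ E m₁ m₂ =
  ((p : ℕ) → p ∈ places N₁ → p ∈ places N₂ → m₁ p ≡ m₂ p) ×
  ((m₁ ∪[ places N₁ ] m₂) ⊨ E)

Rel : {A : Set} → Net A → Presburger → Net A → Presburger → Presburger →
      Marking → Marking → Set
Rel N₁ C₁ N₂ C₂ E m₁ m₂ = (m₁ ⊨ C₁) × EqE N₁ N₂ E m₁ m₂ × (m₂ ⊨ C₂)

Simulates : {A : Set} → Net A → Presburger → Net A → Presburger → Presburger → Set
Simulates N₁ C₁ N₂ C₂ E =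
  ((m₁ : Marking) → m₁ ⊨ C₁ → Σ Marking λ m₂ → Rel N₁ C₁ N₂ C₂ E m₁ m₂) ×
  ((m₁ m₁' m₂ : Marking) → WRun N₁ m₁ [] m₁' →
     EqE N₁ N₂ E m₁ m₂ → EqE N₁ N₂ E m₁' m₂) ×
  ((σ : List _) (m₁ m₁' m₂ m₂' : Marking) → WRun N₁ m₁ σ m₁' →
     Rel N₁ C₁ N₂ C₂ E m₁ m₂ → EqE N₁ N₂ E m₁' m₂' → WRun N₂ m₂ σ m₂')

Bisim : {A : Set} → Net A → Presburger → Net A → Presburger → Presburger → Set
Bisim N₁ C₁ N₂ C₂ E = Simulates N₁ C₁ N₂ C₂ E × Simulates N₂ C₂ N₁ C₁ E

module Ops {A : Set} (_≟A_ : DecidableEquality A) (N : Net A) where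

  isLab : (t : Tr N) (a : A) → Dec (lab N t ≡ just a)
  isLab t a = ≡-dec _≟A_ (lab N t) (just a)

  record NotLab (a : A) : Set where
    constructor notLab
    field
      tr  : Tr N
      .ne : lab N tr ≢ just a

  record HasLab (a : A) : Set where
    constructor hasLab
    field
      tr  : Tr N
      .eq : lab N tr ≡ just a

  filterNot : (a : A) → List (Tr N) → List (NotLab a)
  filterNot a [] = []
  filterNot a (t ∷ ts) with isLab t a
  ... | yes _ = filterNot a ts
  ... | no ¬p = notLab t ¬p ∷ filterNot a ts

  filterHas : (a : A) → List (Tr N) → List (HasLab a)
  filterHas a [] = []
  filterHas a (t ∷ ts) with isLab t a
  ... | yes p = hasLab t p ∷ filterHas a ts
  ... | no _  = filterHas a ts

  filterNot-complete : (a : A) (x : NotLab a) (ts : List (Tr N)) →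
                       NotLab.tr x ∈ ts → x ∈ filterNot a ts
  filterNot-complete a (notLab t ne) (.t ∷ ts) (here refl) with isLab t a
  ... | yes p = Irr.⊥-elim (ne p)
  ... | no _  = here refl
  filterNot-complete a x (t ∷ ts) (there q) with isLab t a
  ... | yes _ = filterNot-complete a x ts q
  ... | no _  = there (filterNot-complete a x ts q)

  filterHas-complete : (a : A) (x : HasLab a) (ts : List (Tr N)) →
                       HasLab.tr x ∈ ts → x ∈ filterHas a ts
  filterHas-complete a (hasLab t eq) (.t ∷ ts) (here refl) with isLab t a
  ... | yes _ = here refl
  ... | no ¬p = Irr.⊥-elim (¬p eq)
  filterHas-complete a x (t ∷ ts) (there q) with isLab t a
  ... | yes _ = there (filterHas-complete a x ts q)
  ... | no _  = filterHas-complete a x ts q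

  Tminus : A → Net A
  Tminus a = record
    { places     = places N
    ; Tr         = NotLab a
    ; trList     = filterNot a (trList N)
    ; trComplete = λ x → filterNot-complete a x (trList N) (trComplete N (NotLab.tr x))
    ; Pre        = λ x → Pre N (NotLab.tr x)
    ; Post       = λ x → Post N (NotLab.tr x)
    ; lab        = λ x → lab N (NotLab.tr x)
    }

  -- T⁺(a,b): T × {0} ∪ l⁻¹(a) × {1}; copies are labelled b
  PlusTr : A → Set
  PlusTr a = Tr N ⊎ HasLab a

  plusList : (a : A) → List (PlusTr a)
  plusList a = map inj₁ (trList N) ++ map inj₂ (filterHas a (trList N))

  plusComplete : (a : A) (x : PlusTr a) → x ∈ plusList a
  plusComplete a (inj₁ t) = ∈-++⁺ˡ (∈-map⁺ inj₁ (trComplete N t))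
  plusComplete a (inj₂ x) = ∈-++⁺ʳ (map inj₁ (trList N))
    (∈-map⁺ inj₂ (filterHas-complete a x (trList N) (trComplete N (HasLab.tr x))))

  plusTr : (a : A) → PlusTr a → Tr N
  plusTr a (inj₁ t) = t
  plusTr a (inj₂ x) = HasLab.tr x

  plusLab : (a b : A) → PlusTr a → Maybe A
  plusLab a b (inj₁ t) = lab N t
  plusLab a b (inj₂ x) = just b

  Tplus : A → A → Net A
  Tplus a b = record
    { places     = places N
    ; Tr         = PlusTr a
    ; trList     = plusList a
    ; trComplete = plusComplete a
    ; Pre        = λ x → Pre N (plusTr a x)
    ; Post       = λ x → Post N (plusTr a x)
    ; lab        = plusLab a b
    }

open Ops public using (Tminus; Tplus)

FormulaOver : Presburger → List ℕ → Set
FormulaOver φ P = All (λ p → p ∈ P) (fv φ)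

-- Both T⁻(a) and T⁺(a,b) refine N: their transitions map onto transitions of N with
-- the same places, pre- and post-sets, and labels related letterwise by a relation R
-- (for T⁻(a): equality on letters other than a; for T⁺(a,b): equality, or the copy
-- label b standing for a), while every transition of N lifts along any label
-- R-related to its own. Runs therefore transfer in both directions up to R on label
-- words, and coherence and the simulation conditions only ever ask for runs; since
-- the same R is used for N₁ and N₂, a word of one derived net is matched through an
-- R-related word of the original nets.
module Submission where

open import Defs
open import Data.Nat using (ℕ; _+_; _∸_; _≤_)
open import Data.Product using (Σ; _×_; _,_)
open import Data.Sum using (_⊎_; inj₁; inj₂)
open import Data.List using (List; []; _∷_; _∷ʳ_; _?∷_; map)
open import Data.List.Membership.Propositional using (_∈_)
open import Data.List.Relation.Unary.All using (All)
open import Data.List.Relation.Binary.Pointwise using (Pointwise; []; _∷_)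
open import Data.Maybe using (Maybe; just; nothing)
open import Data.Maybe.Relation.Binary.Pointwise as MaybeRel using (just; nothing)
  renaming (Pointwise to MaybeRel)
import Data.Empty.Irrelevant as Irr
open import Relation.Nullary using (yes; no)
open import Relation.Binary.Definitions using (DecidableEquality)
open import Relation.Binary.PropositionalEquality
  using (_≡_; _≢_; refl; sym; cong; cong₂; subst; subst₂)

module _ {A B : Set} {R : A → B → Set} where

  ?∷⁺ : ∀ {ℓ ℓ' xs ys} → MaybeRel R ℓ ℓ' → Pointwise R xs ys →
        Pointwise R (ℓ ?∷ xs) (ℓ' ?∷ ys)
  ?∷⁺ nothing  rs = rs
  ?∷⁺ (just r) rs = r ∷ rs

  ?∷⁻ : ∀ {xs} ℓ' {ys} → Pointwise R xs (ℓ' ?∷ ys) →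
        Σ (Maybe A) λ ℓ → Σ (List A) λ xs₀ →
        xs ≡ ℓ ?∷ xs₀ × MaybeRel R ℓ ℓ' × Pointwise R xs₀ ys
  ?∷⁻ nothing  rs       = nothing , _ , refl , nothing , rs
  ?∷⁻ (just y) (r ∷ rs) = just _ , _ , refl , just r , rs

  ∷ʳ⁻ : ∀ {xs} ys {y} → Pointwise R xs (ys ∷ʳ y) →
        Σ (List A) λ xs₀ → Σ A λ x → xs ≡ xs₀ ∷ʳ x × Pointwise R xs₀ ys × R x y
  ∷ʳ⁻ []       (r ∷ []) = [] , _ , refl , [] , r
  ∷ʳ⁻ (y ∷ ys) (r ∷ rs) with ∷ʳ⁻ ys rs
  ... | xs₀ , x , refl , rs₀ , r' = _ ∷ xs₀ , x , refl , r ∷ rs₀ , r'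

Firing : List ℕ → (ℕ → ℕ) → (ℕ → ℕ) → Marking → Marking → Set
Firing P pre post m m' = (p : ℕ) → p ∈ P → (pre p ≤ m p) × (m' p ≡ (m p ∸ pre p) + post p)

firing-transport : ∀ {P Q pre pre' post post' m m'} →
  P ≡ Q → pre ≡ pre' → post ≡ post' → Firing P pre post m m' → Firing Q pre' post' m m'
firing-transport refl refl refl f = f

EqE-transport : ∀ {A} {M₁ M₂ N₁ N₂ : Net A} {E m₁ m₂} →
  places M₁ ≡ places N₁ → places M₂ ≡ places N₂ →
  EqE M₁ M₂ E m₁ m₂ → EqE N₁ N₂ E m₁ m₂
EqE-transport {E = E} {m₁} {m₂} = subst₂ (λ P₁ P₂ →
  ((p : ℕ) → p ∈ P₁ → p ∈ P₂ → m₁ p ≡ m₂ p) × ((m₁ ∪[ P₁ ] m₂) ⊨ E))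

record Refinement {A : Set} (R : A → A → Set) (M N : Net A) : Set where
  field
    places-≡ : places M ≡ places N
    π        : Tr M → Tr N
    Pre-π    : ∀ t → Pre M t ≡ Pre N (π t)
    Post-π   : ∀ t → Post M t ≡ Post N (π t)
    lab-π    : ∀ t → MaybeRel R (lab M t) (lab N (π t))
    π-lift   : ∀ t {ℓ} → MaybeRel R ℓ (lab N t) →
               Σ (Tr M) λ t' → π t' ≡ t × lab M t' ≡ ℓ

module RefinementProperties {A : Set} {R : A → A → Set} {M N : Net A}
                            (ρ : Refinement R M N) where
  open Refinement ρ

  ≈ₘ-π : ∀ {m m'} → _≈ₘ_ M m m' → _≈ₘ_ N m m'
  ≈ₘ-π {m} {m'} = subst (λ P → (p : ℕ) → p ∈ P → m p ≡ m' p) places-≡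

  ≈ₘ-π⁻ : ∀ {m m'} → _≈ₘ_ N m m' → _≈ₘ_ M m m'
  ≈ₘ-π⁻ {m} {m'} = subst (λ P → (p : ℕ) → p ∈ P → m p ≡ m' p) (sym places-≡)

  fire-π : ∀ {m t m'} → Fire M m t m' → Fire N m (π t) m'
  fire-π {t = t} = firing-transport places-≡ (Pre-π t) (Post-π t)

  fire-lift : ∀ {m t t' m'} → π t' ≡ t → Fire N m t m' → Fire M m t' m'
  fire-lift {t' = t'} refl =
    firing-transport (sym places-≡) (sym (Pre-π t')) (sym (Post-π t'))

  project-run : ∀ {m ϱ m'} → Run M m ϱ m' → Run N m (map π ϱ) m'
  project-run (done e)   = done (≈ₘ-π e)
  project-run (step f r) = step (fire-π f) (project-run r)

  labels-π : ∀ ϱ → Pointwise R (labels M ϱ) (labels N (map π ϱ))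
  labels-π []      = []
  labels-π (t ∷ ϱ) = ?∷⁺ (lab-π t) (labels-π ϱ)

  project : ∀ {m σ m'} → WRun M m σ m' →
            Σ (List A) λ σ' → Pointwise R σ σ' × WRun N m σ' m'
  project (ϱ , refl , r) = labels N (map π ϱ) , labels-π ϱ , map π ϱ , refl , project-run r

  lift-run : ∀ {m ϱ m' σ} → Run N m ϱ m' → Pointwise R σ (labels N ϱ) →
             Σ (List (Tr M)) λ ϱ' → labels M ϱ' ≡ σ × Run M m ϱ' m'
  lift-run (done e) [] = [] , refl , done (≈ₘ-π⁻ e)
  lift-run (step {t = t} f r) rs with ?∷⁻ (lab N t) rs
  ... | ℓ , σ₀ , refl , rℓ , rs₀ with π-lift t rℓ | lift-run r rs₀
  ...   | t' , πt'≡t , lab≡ℓ | ϱ' , labels≡σ₀ , r' =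
    t' ∷ ϱ' , cong₂ _?∷_ lab≡ℓ labels≡σ₀ , step (fire-lift πt'≡t f) r'

  lift : ∀ {m σ σ' m'} → WRun N m σ' m' → Pointwise R σ σ' → WRun M m σ m'
  lift (ϱ , refl , r) rs = lift-run r rs

  lift-strong : ∀ {m σ σ' m'} → SRun N m σ' m' → Pointwise R σ σ' → SRun M m σ m'
  lift-strong (snil e) [] = snil (≈ₘ-π⁻ e)
  lift-strong (ssnoc {σ = σ'} {t = t} w e f) rs with ∷ʳ⁻ σ' rs
  ... | σ₀ , x , refl , rs₀ , r with π-lift t (subst (MaybeRel R (just x)) (sym e) (just r))
  ...   | t' , πt'≡t , lab≡ = ssnoc (lift w rs₀) lab≡ (fire-lift πt'≡t f)

  coherent : ∀ {C} → Coherent N C → Coherent M C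
  coherent cohN m m' σ m⊨C w with project w
  ... | σ' , rs , w' with cohN m m' σ' m⊨C w'
  ...   | m'' , m''⊨C , s , silent = m'' , m''⊨C , lift-strong s rs , lift silent []

open RefinementProperties using (coherent; project; lift)

simulates : ∀ {A} {R : A → A → Set} {M₁ M₂ N₁ N₂ : Net A} {C₁ C₂ E} →
  Refinement R M₁ N₁ → Refinement R M₂ N₂ →
  Simulates N₁ C₁ N₂ C₂ E → Simulates M₁ C₁ M₂ C₂ E
simulates {M₁ = M₁} {M₂} {N₁} {N₂} {C₁} {C₂} {E} ρ₁ ρ₂ (s1 , s2 , s3) = s1′ , s2′ , s3′
  where
    open Refinement using (places-≡)

    to : ∀ {m₁ m₂} → EqE M₁ M₂ E m₁ m₂ → EqE N₁ N₂ E m₁ m₂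
    to = EqE-transport {M₁ = M₁} {M₂} {N₁} {N₂} (places-≡ ρ₁) (places-≡ ρ₂)

    from : ∀ {m₁ m₂} → EqE N₁ N₂ E m₁ m₂ → EqE M₁ M₂ E m₁ m₂
    from = EqE-transport {M₁ = N₁} {N₂} {M₁} {M₂} (sym (places-≡ ρ₁)) (sym (places-≡ ρ₂))

    s1′ : (m₁ : Marking) → m₁ ⊨ C₁ → Σ Marking λ m₂ → Rel M₁ C₁ M₂ C₂ E m₁ m₂
    s1′ m₁ c with s1 m₁ c
    ... | m₂ , c₁ , eq , c₂ = m₂ , c₁ , from eq , c₂

    s2′ : (m₁ m₁' m₂ : Marking) → WRun M₁ m₁ [] m₁' →
          EqE M₁ M₂ E m₁ m₂ → EqE M₁ M₂ E m₁' m₂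
    s2′ m₁ m₁' m₂ w eq with project ρ₁ w
    ... | .[] , [] , w' = from (s2 m₁ m₁' m₂ w' (to eq))

    s3′ : (σ : List _) (m₁ m₁' m₂ m₂' : Marking) → WRun M₁ m₁ σ m₁' →
          Rel M₁ C₁ M₂ C₂ E m₁ m₂ → EqE M₁ M₂ E m₁' m₂' → WRun M₂ m₂ σ m₂'
    s3′ σ m₁ m₁' m₂ m₂' w (c₁ , eq , c₂) eq' with project ρ₁ w
    ... | σ' , rs , w' = lift ρ₂ (s3 σ' m₁ m₁' m₂ m₂' w' (c₁ , to eq , c₂) (to eq')) rs

data Kept {A : Set} (a : A) : A → A → Set where
  kept : ∀ {x} → x ≢ a → Kept a x x

data Relabel {A : Set} (a b : A) : A → A → Set where
  same : ∀ {x} → Relabel a b x x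
  copy : Relabel a b b a

module _ {A : Set} {a : A} where

  kept-refl : (ℓ : Maybe A) → ℓ ≢ just a → MaybeRel (Kept a) ℓ ℓ
  kept-refl nothing  _  = nothing
  kept-refl (just x) ne = just (kept (λ x≡a → ne (cong just x≡a)))

  kept-≡ : ∀ {ℓ ℓ'} → MaybeRel (Kept a) ℓ ℓ' → ℓ' ≡ ℓ
  kept-≡ nothing         = refl
  kept-≡ (just (kept _)) = refl

  kept-≢ : ∀ {ℓ ℓ'} → MaybeRel (Kept a) ℓ ℓ' → ℓ' ≢ just a
  kept-≢ nothing          ()
  kept-≢ (just (kept ne)) refl = ne refl

module _ {A : Set} (_≟A_ : DecidableEquality A) (N : Net A) where
  open Ops _≟A_ N using (NotLab; notLab; HasLab; hasLab; isLab; PlusTr; plusTr; plusLab)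

  Tminus-refines : (a : A) → Refinement (Kept a) (Tminus _≟A_ N a) N
  Tminus-refines a = record
    { places-≡ = refl
    ; π        = NotLab.tr
    ; Pre-π    = λ _ → refl
    ; Post-π   = λ _ → refl
    ; lab-π    = λ { (notLab t ne) → kept-refl (lab N t) (λ e → Irr.⊥-elim (ne e)) }
    ; π-lift   = λ t r → notLab t (kept-≢ r) , refl , kept-≡ r
    }

  -- The label proof stored in HasLab is irrelevant, so it is recovered by deciding again.
  hasLab-lab : ∀ {a} (h : HasLab a) → lab N (HasLab.tr h) ≡ just a
  hasLab-lab {a} (hasLab t e) with isLab t a
  ... | yes p = p
  ... | no ¬p = Irr.⊥-elim (¬p e)

  Tplus-lab-π : ∀ {a b} (t : PlusTr a) →
                MaybeRel (Relabel a b) (plusLab a b t) (lab N (plusTr a t))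
  Tplus-lab-π (inj₁ t) = MaybeRel.refl same
  Tplus-lab-π {b = b} (inj₂ h) =
    subst (MaybeRel (Relabel _ b) (just b)) (sym (hasLab-lab h)) (just copy)

  Tplus-lift : ∀ {a b} t {ℓ} → MaybeRel (Relabel a b) ℓ (lab N t) →
               Σ (PlusTr a) λ t' → plusTr a t' ≡ t × plusLab a b t' ≡ ℓ
  Tplus-lift t r with lab N t in e
  Tplus-lift t nothing     | nothing = inj₁ t , refl , e
  Tplus-lift t (just same) | just _  = inj₁ t , refl , e
  Tplus-lift t (just copy) | just _  = inj₂ (hasLab t e) , refl , refl

  Tplus-refines : (a b : A) → Refinement (Relabel a b) (Tplus _≟A_ N a b) N
  Tplus-refines a b = record
    { places-≡ = refl
    ; π        = plusTr a
    ; Pre-π    = λ _ → refl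
    ; Post-π   = λ _ → refl
    ; lab-π    = Tplus-lab-π
    ; π-lift   = Tplus-lift
    }

-- Markings are total functions on ℕ.
theorem7 : {A : Set} (_≟A_ : DecidableEquality A)
    (N₁ N₂ : Net A) (C₁ C₂ E : Presburger) →
    FormulaOver C₁ (places N₁) → FormulaOver C₂ (places N₂) →
    All (λ p → p ∈ places N₁ ⊎ p ∈ places N₂) (fv E) →
    Coherent N₁ C₁ → Coherent N₂ C₂ →
    Bisim N₁ C₁ N₂ C₂ E →
    (a b : A) →
    ((Coherent (Tminus _≟A_ N₁ a) C₁ × Coherent (Tplus _≟A_ N₁ a b) C₁) ×
     (Coherent (Tminus _≟A_ N₂ a) C₂ × Coherent (Tplus _≟A_ N₂ a b) C₂)) ×
    Bisim (Tminus _≟A_ N₁ a) C₁ (Tminus _≟A_ N₂ a) C₂ E ×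
    Bisim (Tplus _≟A_ N₁ a b) C₁ (Tplus _≟A_ N₂ a b) C₂ E
theorem7 _≟A_ N₁ N₂ C₁ C₂ E _ _ _ coh₁ coh₂ (sim₁₂ , sim₂₁) a b =
  ((coherent minus₁ coh₁ , coherent plus₁ coh₁) ,
   (coherent minus₂ coh₂ , coherent plus₂ coh₂)) ,
  (simulates minus₁ minus₂ sim₁₂ , simulates minus₂ minus₁ sim₂₁) ,
  (simulates plus₁ plus₂ sim₁₂ , simulates plus₂ plus₁ sim₂₁)
  where
    minus₁ : Refinement (Kept a) (Tminus _≟A_ N₁ a) N₁
    minus₁ = Tminus-refines _≟A_ N₁ a
    minus₂ : Refinement (Kept a) (Tminus _≟A_ N₂ a) N₂
    minus₂ = Tminus-refines _≟A_ N₂ a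
    plus₁ : Refinement (Relabel a b) (Tplus _≟A_ N₁ a b) N₁
    plus₁ = Tplus-refines _≟A_ N₁ a b
    plus₂ : Refinement (Relabel a b) (Tplus _≟A_ N₂ a b) N₂
    plus₂ = Tplus-refines _≟A_ N₂ a b
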